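{- Let $\Pi$ be a permutation of $\{1,\dots,n\}$ and $H=G[\Pi]$. Let $C=\{u_1,\dots,u_p\}$ be a color class of a proper vertex coloring of $H$, indexed so that $\Pi^{ -1}(u_1)<\Pi^{ -1}(u_2)<\cdots<\Pi^{ -1}(u_p)$. For $v\in V(H)\setminus C$ let $\mathrm{Ind}(v)=\{t : 1\le t\le p,\ (v,u_t)\in E(H)\}$, and when $\mathrm{Ind}(v)\neq\emptyset$ let $l(v)=\min \mathrm{Ind}(v)$ and $r(v)=\max\mathrm{Ind}(v)$. Then for every $v\in V(H)\setminus C$ with $\mathrm{Ind}(v)\ne\emptyset$, we have $\mathrm{Ind}(v)=\{t : l(v)\le t\le r(v)\}$.
   Context: For a permutation $\Pi$ of $\{1,\dots,n\}$, the graph $G[\Pi]$ has vertex set $\{1,\dots,n\}$ and $i,j$ adjacent iff $(i-j)(\Pi^{ -1}(i)-\Pi^{ -1}(j))<0$. -}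

module Defs where

open import Data.Nat using (ℕ)
open import Data.Fin using (Fin; _<_)
open import Data.Fin.Permutation using (Permutation′; _⟨$⟩ˡ_)
open import Data.Sum using (_⊎_)
open import Data.Product using (_×_)
open import Relation.Binary.PropositionalEquality using (_≡_; _≢_)

Π⁻¹ : ∀ {n} → Permutation′ n → Fin n → Fin n
Π⁻¹ Π i = Π ⟨$⟩ˡ i

Adj : ∀ {n} → Permutation′ n → Fin n → Fin n → Set
Adj Π i j = (i < j × Π⁻¹ Π j < Π⁻¹ Π i) ⊎ (j < i × Π⁻¹ Π i < Π⁻¹ Π j)

ProperColoring : ∀ {n} → Permutation′ n → (Fin n → ℕ) → Set
ProperColoring Π c = ∀ i j → Adj Π i j → c i ≢ c j

Ind : ∀ {n p} → Permutation′ n → (Fin p → Fin n) → Fin n → Fin p → Set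
Ind Π u v t = Adj Π v (u t)

-- The vertices of a colour class are pairwise non-adjacent, so ordering them by position
-- also orders them by value: they form a chain u₁ ≺ ⋯ ≺ uₚ in the product order.  The
-- neighbours of v on such a chain are either all up-left of v or all down-right of v,
-- and each of these two regions is convex in the product order.
module Submission where

open import Defs
open import Data.Nat using (ℕ)
open import Data.Fin using (Fin; _<_; _≤_)
open import Data.Fin.Permutation using (Permutation′)
open import Data.Product using (_×_; ∃; _,_)
open import Data.Sum using (inj₁; inj₂)
open import Data.Empty using (⊥-elim)
open import Relation.Nullary using (¬_)
open import Relation.Binary.Core using (_Preserves_⟶_)
open import Relation.Binary.Definitions using (tri<; tri≈; tri>)
open import Relation.Binary.PropositionalEquality using (_≡_; _≢_; refl; sym; trans)
open import Function.Base using (_∘_)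
open import Function.Bundles using (_⇔_; mk⇔)
import Data.Nat.Properties as ℕ
import Data.Fin.Properties as Fin

private
  variable
    n p : ℕ

strictMono⇒mono : {f : Fin p → Fin n} →
                  f Preserves _<_ ⟶ _<_ → f Preserves _≤_ ⟶ _≤_
strictMono⇒mono f-mono {s} {t} s≤t with Fin.<-cmp s t
... | tri< s<t _ _ = ℕ.<⇒≤ (f-mono s<t)
... | tri≈ _ refl _ = Fin.≤-refl
... | tri> _ _ t<s = ⊥-elim (ℕ.<⇒≱ t<s s≤t)

¬Adj⇒samePositionOrder : (Π : Permutation′ n) {x y : Fin n} →
                         ¬ Adj Π x y → Π⁻¹ Π x < Π⁻¹ Π y → x < y
¬Adj⇒samePositionOrder Π {x} {y} ¬adj Πx<Πy with Fin.<-cmp x y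
... | tri< x<y _ _ = x<y
... | tri≈ _ refl _ = ⊥-elim (ℕ.<-irrefl refl Πx<Πy)
... | tri> _ _ y<x = ⊥-elim (¬adj (inj₂ (y<x , Πx<Πy)))

colourClass-increasing : (Π : Permutation′ n) {c : Fin n → ℕ} {k : ℕ} {u : Fin p → Fin n} →
                         ProperColoring Π c → (∀ t → c (u t) ≡ k) →
                         (Π⁻¹ Π ∘ u) Preserves _<_ ⟶ _<_ → u Preserves _<_ ⟶ _<_
colourClass-increasing Π {u = u} col cu pos-mono {s} {t} s<t =
  ¬Adj⇒samePositionOrder Π (λ adj → col (u s) (u t) adj (trans (cu s) (sym (cu t)))) (pos-mono s<t)

Adj-convex : (Π : Permutation′ n) {v x y z : Fin n} →
             x ≤ y → y ≤ z → Π⁻¹ Π x ≤ Π⁻¹ Π y → Π⁻¹ Π y ≤ Π⁻¹ Π z →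
             Adj Π v x → Adj Π v z → Adj Π v y
Adj-convex Π x≤y y≤z Πx≤Πy Πy≤Πz (inj₁ (v<x , _)) (inj₁ (_ , Πz<Πv)) =
  inj₁ (ℕ.<-≤-trans v<x x≤y , ℕ.≤-<-trans Πy≤Πz Πz<Πv)
Adj-convex Π x≤y y≤z Πx≤Πy Πy≤Πz (inj₂ (_ , Πv<Πx)) (inj₂ (z<v , _)) =
  inj₂ (ℕ.≤-<-trans y≤z z<v , ℕ.<-≤-trans Πv<Πx Πx≤Πy)
Adj-convex Π x≤y y≤z Πx≤Πy Πy≤Πz (inj₁ (v<x , _)) (inj₂ (z<v , _)) =
  ⊥-elim (ℕ.<-asym v<x (ℕ.≤-<-trans (ℕ.≤-trans x≤y y≤z) z<v))
Adj-convex Π x≤y y≤z Πx≤Πy Πy≤Πz (inj₂ (_ , Πv<Πx)) (inj₁ (_ , Πz<Πv)) =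
  ⊥-elim (ℕ.<-asym Πv<Πx (ℕ.≤-<-trans (ℕ.≤-trans Πx≤Πy Πy≤Πz) Πz<Πv))

lemma2 : ∀ (n : ℕ) (Π : Permutation′ n) (c : Fin n → ℕ) → ProperColoring Π c →
         ∀ (k : ℕ) (p : ℕ) (u : Fin p → Fin n) →
         (∀ t → c (u t) ≡ k) → (∀ v → c v ≡ k → ∃ λ t → u t ≡ v) →
         (∀ s t → s < t → Π⁻¹ Π (u s) < Π⁻¹ Π (u t)) →
         ∀ (v : Fin n) → c v ≢ k →
         ∀ (l r : Fin p) →
         Ind Π u v l → (∀ t → Ind Π u v t → l ≤ t) →
         Ind Π u v r → (∀ t → Ind Π u v t → t ≤ r) →
         ∀ t → (Ind Π u v t ⇔ (l ≤ t × t ≤ r))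
lemma2 n Π c col k p u cu _ pos-mono v _ l r ind-l l-min ind-r r-max t =
  mk⇔ (λ ind-t → l-min t ind-t , r-max t ind-t)
      (λ (l≤t , t≤r) → Adj-convex Π (value-mono l≤t) (value-mono t≤r)
                                     (position-mono l≤t) (position-mono t≤r) ind-l ind-r)
  where
  position-strictMono : (Π⁻¹ Π ∘ u) Preserves _<_ ⟶ _<_
  position-strictMono {s} {t} = pos-mono s t

  position-mono : (Π⁻¹ Π ∘ u) Preserves _≤_ ⟶ _≤_
  position-mono = strictMono⇒mono position-strictMono

  value-mono : u Preserves _≤_ ⟶ _≤_
  value-mono = strictMono⇒mono (colourClass-increasing Π col cu position-strictMono)
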